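{- Let $a$ be a $2$-automatic sequence. The following are equivalent: (R1) $a$ has global relations of all types; (R2) the monoid $G(a)$ is a group; (R3) $a$ can be produced by a $2$-automaton whose underlying labeled graph is the Schreier graph of a group $G$ with distinguished generators $t_0,t_1$ acting faithfully and transitively on a finite set $Q$ (for some choice of initial state $q_0\in Q$ and labeling map $\tau\colon Q\to\Delta$). Moreover, suppose $G$, $Q$, $q_0$ and $\tau$ are as in (R3) and produce $a$. Then $|Q|\ge |N(a)|$, with equality if and only if the following condition holds: ($\dagger$) for every $h\in G$, if $\tau(q_0^{hg})=\tau(q_0^{g})$ for all $g\in G$, then $q_0^h=q_0$. In the case of equality, there is a group isomorphism $\theta\colon G\to G(a)$ with $\theta(t_i)=t_i$ for $i=0,1$, and a bijection $\varphi\colon Q\to N(a)$ with $\varphi(q_0)=a$ and $\varphi(q^{t_i})=\varphi(q)^{t_i}$ for all $q\in Q$ and $i=0,1$.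
   Context: Sequences are indexed from $n=1$. A $p$-automaton ($p\ge2$) consists of a finite set $Q$ of states, an initial state $q_0$, a labeling map $\tau\colon Q\to\Delta$ to a finite alphabet $\Delta$, and for each state $q$ and each $i\in\{0,\dots,p-1\}$ exactly one outgoing arrow labeled $i$; it produces the sequence $(a_n)_{n\ge1}$ where $a_n$ is the label of the state reached from $q_0$ by following successively the arrows labeled by the base-$p$ digits of $n$, read from right (least significant) to left (most significant). A sequence is $p$-automatic if some $p$-automaton produces it. For integers $i,j\ge0$ with $j<p^i$, $a^{(i,j)}=(a_{p^in+j})_{n\ge1}$, and $N(a)=\{a^{(i,j)}\}$ (a finite set when $a$ is automatic). A relation of a sequence $u$ is a pair $(i,j)\ne(0,0)$ with $i,j\ge0$, $j<p^i$, $u^{(i,j)}=u$; $\operatorname{rel}(u)$ is the set of these. The type of a relation $(i,j)$ is the leftmost digit of $j$ written in base $p$ padded with zeros on the left to exactly $i$ digits. A global relation for $a$ is an element of $\bigcap_{u\in N(a)}\operatorname{rel}(u)$; $a$ has global relations of all types if for each $r\in\{0,\dots,p-1\}$ there is a global relation of type $r$. For $u\in N(a)$ and $0\le i<p$ put $u^{t_i}=(u_{pn+i})_{n\ge1}\in N(a)$; $G(a)$ is the monoid of self-maps of $N(a)$ generated by $t_0,\dots,t_{p-1}$, with maps written on the right ($u^{gh}=(u^g)^h$, i.e. $gh$ means first $g$ then $h$); "$G(a)$ is a group" means each $t_i$ is a bijection of $N(a)$. If a group $G$ with distinguished generators $t_0,\dots,t_{p-1}$ acts on the right on a set $Q$ ($q\mapsto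 q^g$), its Schreier graph has vertex set $Q$ and an arrow labeled $i$ from $q$ to $q^{t_i}$ for each $q$ and $i$. -}

module Defs where

open import Level using (0ℓ) renaming (suc to lsuc)
open import Data.Nat using (ℕ; zero; suc; _+_; _*_; _∸_; _^_; _≤_; _<_; NonZero)
open import Data.Nat.DivMod using (_/_; _mod_)
open import Data.Nat.Properties using (m^n≢0)
open import Data.Fin using (toℕ)
open import Data.Fin using (Fin)
open import Data.List using (List; []; _∷_; foldl; _++_)
open import Data.Bool using (Bool; true; false)
open import Data.Product using (Σ; ∃; _×_; _,_)
open import Relation.Binary.PropositionalEquality using (_≡_; _≢_)
open import Relation.Nullary using (¬_)
open import Algebra.Bundles using (Group)
open import Function.Bundles using (_⇔_)

-- Sequences (a_n)_{n ≥ 1} over an alphabet Δ.  A sequence is a function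
-- ℕ → Δ whose value at 0 is ignored; equality of sequences is pointwise
-- equality at all indices n ≥ 1.

Seq : Set → Set
Seq Δ = ℕ → Δ

_≈ˢ_ : ∀ {Δ : Set} → Seq Δ → Seq Δ → Set
u ≈ˢ v = ∀ n → u (suc n) ≡ v (suc n)

record Automaton (p : ℕ) (Δ : Set) : Set where
  field
    nQ : ℕ
    δ  : Fin nQ → Fin p → Fin nQ
    q₀ : Fin nQ
    τ  : Fin nQ → Δ

-- Run the automaton on the base-p digits of n, least significant first.
-- The first argument is fuel (fuel n suffices for p ≥ 2).
runF : ∀ {p} .{{_ : NonZero p}} {Q : Set} → (Q → Fin p → Q) → ℕ → Q → ℕ → Q
runF δ zero    q n       = q
runF δ (suc f) q zero    = q
runF {p} δ (suc f) q (suc n) = runF δ f (δ q (suc n mod p)) (suc n / p)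

output : ∀ {p} .{{_ : NonZero p}} {Δ : Set} → Automaton p Δ → Seq Δ
output A n = Automaton.τ A (runF (Automaton.δ A) n (Automaton.q₀ A) n)

Produces : ∀ {p} .{{_ : NonZero p}} {Δ : Set} → Automaton p Δ → Seq Δ → Set
Produces A a = a ≈ˢ output A

IsAutomatic : (p : ℕ) .{{_ : NonZero p}} {Δ : Set} → Seq Δ → Set
IsAutomatic p {Δ} a = Σ (Automaton p Δ) λ A → Produces A a

sub : ∀ {Δ : Set} → ℕ → Seq Δ → ℕ → ℕ → Seq Δ
sub p a i j n = a (p ^ i * n + j)

tmap : ∀ {Δ : Set} → ℕ → Seq Δ → ℕ → Seq Δ
tmap p u i n = u (p * n + i)

InN : ∀ {Δ : Set} → ℕ → Seq Δ → Seq Δ → Set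
InN p a u = Σ ℕ λ i → Σ ℕ λ j → (j < p ^ i) × (u ≈ˢ sub p a i j)

IsRelation : ∀ {Δ : Set} → ℕ → Seq Δ → ℕ → ℕ → Set
IsRelation p u i j = (j < p ^ i) × ¬ (i ≡ 0 × j ≡ 0) × (sub p u i j ≈ˢ u)

-- type of (i,j): leftmost digit of j written with exactly i base-p digits
relType : (p : ℕ) .{{_ : NonZero p}} → ℕ → ℕ → ℕ
relType p i j = _/_ j (p ^ (i ∸ 1)) {{m^n≢0 p (i ∸ 1)}}

IsGlobalRelation : ∀ {Δ : Set} → ℕ → Seq Δ → ℕ → ℕ → Set
IsGlobalRelation p a i j = ∀ u → InN p a u → IsRelation p u i j

GlobalRelationsOfAllTypes : ∀ {Δ : Set} (p : ℕ) .{{_ : NonZero p}} → Seq Δ → Set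
GlobalRelationsOfAllTypes p a =
  ∀ r → r < p → Σ ℕ λ i → Σ ℕ λ j → IsGlobalRelation p a i j × relType p i j ≡ r

-- Elements of G(a) are represented by words
-- in the generators (List (Fin p)), acting on the right, two words being
-- the same element of G(a) iff they induce the same map of N(a).

tword : ∀ {Δ : Set} (p : ℕ) → Seq Δ → List (Fin p) → Seq Δ
tword p u w = foldl (λ v i → tmap p v (toℕ i)) u w

_∼[_,_]_ : ∀ {Δ : Set} {p : ℕ} → List (Fin p) → ℕ → Seq Δ → List (Fin p) → Set
_∼[_,_]_ {p = p₀} w p a w' = ∀ u → InN p a u → tword p₀ u w ≈ˢ tword p₀ u w'

TIsBijection : ∀ {Δ : Set} → ℕ → Seq Δ → ℕ → Set
TIsBijection p a i =
  (∀ u v → InN p a u → InN p a v → tmap p u i ≈ˢ tmap p v i → u ≈ˢ v)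
  × (∀ v → InN p a v → Σ (Seq _) λ u → InN p a u × (tmap p u i ≈ˢ v))

-- (R2): G(a) is a group, i.e. each t_i (0 ≤ i < p) is a bijection of N(a)
GIsGroup : ∀ {Δ : Set} (p : ℕ) → Seq Δ → Set
GIsGroup p a = (i : Fin p) → TIsBijection p a (toℕ i)

HasCardN : ∀ {Δ : Set} → ℕ → Seq Δ → ℕ → Set
HasCardN {Δ} p a k =
  Σ (Fin k → Seq Δ) λ u →
    (∀ x → InN p a (u x))
    × (∀ x y → u x ≈ˢ u y → x ≡ y)
    × (∀ v → InN p a v → ∃ λ x → v ≈ˢ u x)

-- Group words in the generators t_i and their inverses
-- ((i , false) stands for t_i, (i , true) for t_i⁻¹).
evalGroupWord : ∀ {p} (G : Group 0ℓ 0ℓ) → (Fin p → Group.Carrier G)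
                → List (Fin p × Bool) → Group.Carrier G
evalGroupWord G t [] = Group.ε G
evalGroupWord G t ((i , false) ∷ w) = Group._∙_ G (t i) (evalGroupWord G t w)
evalGroupWord G t ((i , true) ∷ w) =
  Group._∙_ G (Group._⁻¹ G (t i)) (evalGroupWord G t w)

record SchreierAutomaton (p : ℕ) (Δ : Set) : Set₁ where
  field
    G   : Group 0ℓ 0ℓ
  open Group G public using (Carrier; _≈_; _∙_; ε; _⁻¹)
  field
    t          : Fin p → Carrier
    generates  : ∀ g → Σ (List (Fin p × Bool)) λ w → evalGroupWord G t w ≈ g
    nQ         : ℕ
    act        : Fin nQ → Carrier → Fin nQ
    act-cong   : ∀ q {g h} → g ≈ h → act q g ≡ act q h
    act-ε      : ∀ q → act q ε ≡ q
    act-∙      : ∀ q g h → act q (g ∙ h) ≡ act (act q g) h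
    faithful   : ∀ g h → (∀ q → act q g ≡ act q h) → g ≈ h
    transitive : ∀ q q′ → Σ Carrier λ g → act q g ≡ q′
    q₀         : Fin nQ
    τ          : Fin nQ → Δ

  automaton : Automaton p Δ
  automaton = record { nQ = nQ ; δ = λ q i → act q (t i) ; q₀ = q₀ ; τ = τ }

  Dagger : Set
  Dagger = ∀ h → (∀ g → τ (act q₀ (h ∙ g)) ≡ τ (act q₀ g)) → act q₀ h ≡ q₀

ProducedBySchreier : ∀ {Δ : Set} (p : ℕ) .{{_ : NonZero p}} → Seq Δ → Set₁
ProducedBySchreier {Δ} p a =
  Σ (SchreierAutomaton p Δ) λ S → Produces (SchreierAutomaton.automaton S) a

IsoData : ∀ {Δ : Set} (p : ℕ) → Seq Δ → SchreierAutomaton p Δ → Set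
IsoData {Δ} p a S =
  (Σ (Carrier → List (Fin p)) λ θ →
      (∀ g h → g ≈ h → θ g ∼[ p , a ] θ h)
    × (∀ g h → θ (g ∙ h) ∼[ p , a ] (θ g ++ θ h))
    × (∀ g h → θ g ∼[ p , a ] θ h → g ≈ h)
    × (∀ w → Σ Carrier λ g → θ g ∼[ p , a ] w)
    × (∀ i → θ (t i) ∼[ p , a ] (i ∷ [])))
  × (Σ (Fin nQ → Seq Δ) λ φ →
      (∀ q → InN p a (φ q))
    × (∀ q q′ → φ q ≈ˢ φ q′ → q ≡ q′)
    × (∀ u → InN p a u → Σ (Fin nQ) λ q → φ q ≈ˢ u)
    × (φ q₀ ≈ˢ a)
    × (∀ q i → φ (act q (t i)) ≈ˢ tmap p (φ q) (toℕ i)))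
  where open SchreierAutomaton S

-- Fix an automaton for a and write ⟦q⟧ for the sequence it produces from state q. Then N(a) consists of
-- the ⟦q⟧ with q reachable, and u ↦ u^{t_r} follows the r-arrows; by pigeonhole on the states,
-- t_r^{nQ} = t_r^{nQ + nQ !} on N(a).
-- (R1 ⇒ R2) A global relation of type r gives a word V with u^{t_V t_r} = u on N(a), so t_r is onto and
-- therefore t_r^{nQ !} = id on N(a), which makes t_r a bijection.
-- (R2 ⇒ R3) Equality of the ⟦q⟧ is decidable by pumping, so N(a) can be enumerated; t_0 and t_1 permute
-- it, and the group of signed words acting on N(a), with u labelled by the first term of u^{t_1⁻¹},
-- is a Schreier automaton producing a.
-- (R3 ⇒ R1) In a Schreier automaton t_r has order dividing nQ !, so (nQ !, num t_r^{nQ !}) is a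
-- global relation of type r.
-- For a Schreier automaton producing a, q ↦ ⟦q⟧ maps Q onto N(a), so |Q| ≥ |N(a)|; and ⟦q⟧ = ⟦q′⟧ iff
-- q and q′ carry the same labels along every g ∈ G. Hence the map is injective exactly under (†), that is,
-- exactly when |Q| = |N(a)|, and it then identifies the action of G on Q with that of G(a) on N(a).

module Submission where

open import Defs
open import Data.Nat using (ℕ; zero; suc; pred; _+_; _*_; _∸_; _^_; _≤_; _<_; z≤n; s≤s; NonZero; _%_; _/_; _!; _<?_)
open import Data.Nat.Properties
open import Data.Nat.DivMod
  using (_mod_; m≡m%n+[m/n]*n; [m+kn]%n≡m%n; m<n⇒m%n≡m; m%n<n; m<n*o⇒m/o<n; m/n<m; m≥n⇒m/n>0;
         +-distrib-/-∣ʳ; m<n⇒m/n≡0; m*n/n≡m; /-congˡ)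
open import Data.Nat.Divisibility using (_∣_; divides; ∣-trans; m≤n⇒m!∣n!)
open import Data.Nat.GeneralisedArithmetic using (fold; iterate)
open import Data.Fin using (Fin; toℕ; fromℕ<; punchOut; combine) renaming (suc to fsuc)
open import Data.Fin.Patterns using (0F; 1F)
open import Data.Fin.Properties using (toℕ-fromℕ<; toℕ-injective; toℕ<n; pigeonhole; any?; punchOut-injective; injective⇒≤; combine-injective)
  renaming (_≟_ to _≟ᶠ_)
open import Data.List using (List; []; _∷_; [_]; foldl; _++_; _∷ʳ_; length; replicate; map; take; drop; lookup)
open import Data.List.Properties using (++-assoc; ++-identityʳ; foldl-++; foldl-∷ʳ; foldl-map; length-++; length-replicate; length-take; length-drop; take++drop≡id)
open import Data.List.Membership.Propositional using (_∈_)
open import Data.List.Membership.Propositional.Properties using (∈-++⁺ˡ; ∈-++⁺ʳ; ∈-map⁺)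
open import Data.List.Relation.Unary.Any using (here; there)
open import Data.Product using (Σ; ∃; _×_; _,_; proj₁; proj₂)
open import Relation.Nullary using (Dec; contradiction; yes; no)
open import Relation.Nullary.Decidable using (map′)
open import Relation.Binary.Definitions using (DecidableEquality)
import Data.List.Relation.Unary.All as All
open import Function.Definitions using (Injective)
open import Algebra.Bundles using (Group)
open import Data.Bool using (Bool; true; false; not)
open import Data.Empty using (⊥-elim)
open import Function.Base using (_∘_)
open import Function.Bundles using (_⇔_; mk⇔; Equivalence)
open import Level using (0ℓ)
open import Relation.Binary.Bundles using (Setoid)
import Relation.Binary.Reasoning.Setoid as SetoidReasoning
open import Relation.Binary.PropositionalEquality hiding ([_])
open import Data.Nat.Tactic.RingSolver using (solve-∀)

-- Least significant digit first, as read by runF.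
Word : Set
Word = List (Fin 2)

num : Word → ℕ
num []      = 0
num (b ∷ w) = toℕ b + 2 * num w

num-++ : ∀ w x → num (w ++ x) ≡ num w + 2 ^ length w * num x
num-++ []      x = sym (+-identityʳ (num x))
num-++ (b ∷ w) x = begin
  toℕ b + 2 * num (w ++ x)                      ≡⟨ cong (λ n → toℕ b + 2 * n) (num-++ w x) ⟩
  toℕ b + 2 * (num w + 2 ^ length w * num x)    ≡⟨ regroup (toℕ b) (num w) (2 ^ length w) (num x) ⟩
  toℕ b + 2 * num w + 2 * 2 ^ length w * num x  ∎
  where
  open ≡-Reasoning
  regroup : ∀ b w k x → b + 2 * (w + k * x) ≡ b + 2 * w + 2 * k * x
  regroup = solve-∀

num<2^length : ∀ w → num w < 2 ^ length w
num<2^length []      = s≤s z≤n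
num<2^length (b ∷ w) = begin-strict
  toℕ b + 2 * num w  <⟨ +-monoˡ-< (2 * num w) (toℕ<n b) ⟩
  2 + 2 * num w      ≡⟨ *-distribˡ-+ 2 1 (num w) ⟨
  2 * suc (num w)    ≤⟨ *-monoʳ-≤ 2 (num<2^length w) ⟩
  2 * 2 ^ length w   ∎
  where open ≤-Reasoning

[r+n*q]%n≡r : ∀ r n q .{{_ : NonZero n}} → r < n → (r + n * q) % n ≡ r
[r+n*q]%n≡r r n q r<n =
  trans (cong (λ x → (r + x) % n) (*-comm n q)) (trans ([m+kn]%n≡m%n r q n) (m<n⇒m%n≡m r<n))

[r+n*q]/n≡q : ∀ r n q .{{_ : NonZero n}} → r < n → (r + n * q) / n ≡ q
[r+n*q]/n≡q r n q r<n = begin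
  (r + n * q) / n    ≡⟨ +-distrib-/-∣ʳ r (divides q (*-comm n q)) ⟩
  r / n + n * q / n  ≡⟨ cong₂ _+_ (m<n⇒m/n≡0 r<n) (trans (cong (_/ n) (*-comm n q)) (m*n/n≡m q n)) ⟩
  q                  ∎
  where open ≡-Reasoning

digit-mod : ∀ (b : Fin 2) k → (toℕ b + 2 * k) mod 2 ≡ b
digit-mod b k = toℕ-injective (trans (toℕ-fromℕ< _) ([r+n*q]%n≡r (toℕ b) 2 k (toℕ<n b)))

digit-div : ∀ (b : Fin 2) k → (toℕ b + 2 * k) / 2 ≡ k
digit-div b k = [r+n*q]/n≡q (toℕ b) 2 k (toℕ<n b)

num-mod-div : ∀ n → toℕ (n mod 2) + 2 * (n / 2) ≡ n
num-mod-div n = begin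
  toℕ (n mod 2) + 2 * (n / 2)  ≡⟨ cong (_+ 2 * (n / 2)) (toℕ-fromℕ< (m%n<n n 2)) ⟩
  n % 2 + 2 * (n / 2)          ≡⟨ cong (n % 2 +_) (*-comm 2 (n / 2)) ⟩
  n % 2 + n / 2 * 2            ≡⟨ m≡m%n+[m/n]*n n 2 ⟨
  n                            ∎
  where open ≡-Reasoning

-- The first argument is fuel, as in runF.
binary : ℕ → ℕ → Word
binary zero    n       = []
binary (suc f) zero    = []
binary (suc f) (suc n) = suc n mod 2 ∷ binary f (suc n / 2)

bits : ℕ → Word
bits n = binary n n

runF≡foldl-binary : ∀ {Q : Set} (δ : Q → Fin 2 → Q) f q n → runF δ f q n ≡ foldl δ q (binary f n)
runF≡foldl-binary δ zero    q n       = refl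
runF≡foldl-binary δ (suc f) q zero    = refl
runF≡foldl-binary δ (suc f) q (suc n) = runF≡foldl-binary δ f (δ q (suc n mod 2)) (suc n / 2)

binary-zero : ∀ f → binary f 0 ≡ []
binary-zero zero    = refl
binary-zero (suc f) = refl

num-∷ʳ1>0 : ∀ v → 0 < num (v ∷ʳ 1F)
num-∷ʳ1>0 []      = s≤s z≤n
num-∷ʳ1>0 (b ∷ v) = ≤-trans (num-∷ʳ1>0 v) (≤-trans (m≤m+n _ _) (m≤n+m _ (toℕ b)))

half-fuel : ∀ (b : Fin 2) k f → 0 < k → toℕ b + 2 * k ≤ suc f → k ≤ f
half-fuel b k f k>0 le = ≤-pred (begin-strict
  k              <⟨ m<m+n k k>0 ⟩
  k + k          ≡⟨ cong (k +_) (+-identityʳ k) ⟨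
  2 * k          ≤⟨ m≤n+m (2 * k) (toℕ b) ⟩
  toℕ b + 2 * k  ≤⟨ le ⟩
  suc f          ∎)
  where open ≤-Reasoning

binary-suc : ∀ f {n} → 0 < n → binary (suc f) n ≡ n mod 2 ∷ binary f (n / 2)
binary-suc f {suc n} _ = refl

binary-num : ∀ f v → num (v ∷ʳ 1F) ≤ f → binary f (num (v ∷ʳ 1F)) ≡ v ∷ʳ 1F
binary-num (suc f) []      _  = cong (1F ∷_) (binary-zero f)
binary-num zero    (b ∷ v) le = contradiction (≤-trans (num-∷ʳ1>0 (b ∷ v)) le) λ ()
binary-num (suc f) (b ∷ v) le = begin
  binary (suc f) (toℕ b + 2 * k)     ≡⟨ binary-suc f (num-∷ʳ1>0 (b ∷ v)) ⟩
  (toℕ b + 2 * k) mod 2 ∷ binary f ((toℕ b + 2 * k) / 2)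
                                     ≡⟨ cong₂ _∷_ (digit-mod b k) (cong (binary f) (digit-div b k)) ⟩
  b ∷ binary f k                     ≡⟨ cong (b ∷_) (binary-num f v (half-fuel b k f (num-∷ʳ1>0 v) le)) ⟩
  b ∷ v ∷ʳ 1F                        ∎
  where
  open ≡-Reasoning
  k = num (v ∷ʳ 1F)

num-∷ʳ1-surjective : ∀ f n → 0 < n → n ≤ f → ∃ λ v → num (v ∷ʳ 1F) ≡ n
num-∷ʳ1-surjective (suc f) 1             _ _  = [] , refl
num-∷ʳ1-surjective (suc f) n@(suc (suc _)) _ le
  with v , eq ← num-∷ʳ1-surjective f (n / 2) (m≥n⇒m/n>0 {n} {2} (s≤s (s≤s z≤n))) (≤-pred (≤-trans (m/n<m n 2 (s≤s (s≤s z≤n))) le))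
  = n mod 2 ∷ v , trans (cong (λ q → toℕ (n mod 2) + 2 * q) eq) (num-mod-div n)

bits-num : ∀ v → bits (num (v ∷ʳ 1F)) ≡ v ∷ʳ 1F
bits-num v = binary-num _ v ≤-refl

bits-suc : ∀ m → ∃ λ v → bits (suc m) ≡ v ∷ʳ 1F × num (v ∷ʳ 1F) ≡ suc m
bits-suc m with v , eq ← num-∷ʳ1-surjective (suc m) (suc m) (s≤s z≤n) ≤-refl
  = v , trans (cong bits (sym eq)) (bits-num v) , eq

bits-++ : ∀ w m → bits (2 ^ length w * suc m + num w) ≡ w ++ bits (suc m)
bits-++ w m with v , bits≡ , num≡ ← bits-suc m = begin
  bits (2 ^ length w * suc m + num w)          ≡⟨ cong bits (+-comm _ (num w)) ⟩
  bits (num w + 2 ^ length w * suc m)          ≡⟨ cong (λ n → bits (num w + 2 ^ length w * n)) num≡ ⟨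
  bits (num w + 2 ^ length w * num (v ∷ʳ 1F))  ≡⟨ cong bits (num-++ w (v ∷ʳ 1F)) ⟨
  bits (num (w ++ v ∷ʳ 1F))                    ≡⟨ cong (λ x → bits (num x)) (++-assoc w v _) ⟨
  bits (num ((w ++ v) ∷ʳ 1F))                  ≡⟨ bits-num (w ++ v) ⟩
  (w ++ v) ∷ʳ 1F                               ≡⟨ ++-assoc w v _ ⟩
  w ++ v ∷ʳ 1F                                 ≡⟨ cong (w ++_) bits≡ ⟨
  w ++ bits (suc m)                            ∎
  where open ≡-Reasoning

replicate-+ : ∀ {A : Set} m n (x : A) → replicate (m + n) x ≡ replicate m x ++ replicate n x
replicate-+ zero    n x = refl
replicate-+ (suc m) n x = cong (x ∷_) (replicate-+ m n x)

replicate-∷ʳ : ∀ {A : Set} n (x : A) → replicate (suc n) x ≡ replicate n x ∷ʳ x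
replicate-∷ʳ zero    x = refl
replicate-∷ʳ (suc n) x = cong (x ∷_) (replicate-∷ʳ n x)

num-∷ʳ : ∀ v b → num (v ∷ʳ b) ≡ num v + 2 ^ length v * toℕ b
num-∷ʳ v b = trans (num-++ v [ b ]) (cong (λ k → num v + 2 ^ length v * k) (+-identityʳ (toℕ b)))

num-∷ʳ/2^length : ∀ v b {k} → length v ≡ k → (num (v ∷ʳ b) / 2 ^ k) {{m^n≢0 2 k}} ≡ toℕ b
num-∷ʳ/2^length v b refl = trans (/-congˡ (num-∷ʳ v b)) ([r+n*q]/n≡q (num v) (2 ^ length v) (toℕ b) (num<2^length v))
  where instance _ = m^n≢0 2 (length v)

-- j written with exactly i binary digits, that is, j mod 2 ^ i.
digits : ℕ → ℕ → Word
digits zero    j = []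
digits (suc i) j = j mod 2 ∷ digits i (j / 2)

length-digits : ∀ i j → length (digits i j) ≡ i
length-digits zero    j = refl
length-digits (suc i) j = cong suc (length-digits i (j / 2))

num-digits : ∀ i j → j < 2 ^ i → num (digits i j) ≡ j
num-digits zero    zero    _ = refl
num-digits zero    (suc j) (s≤s ())
num-digits (suc i) j j<2^i+1 = trans
  (cong (λ q → toℕ (j mod 2) + 2 * q) (num-digits i (j / 2) (m<n*o⇒m/o<n (subst (j <_) (*-comm 2 (2 ^ i)) j<2^i+1))))
  (num-mod-div j)

tword-sub : ∀ {Δ : Set} (u : Seq Δ) w n → tword 2 u w n ≡ sub 2 u (length w) (num w) n
tword-sub u []      n = cong u (sym (trans (+-identityʳ _) (+-identityʳ n)))
tword-sub u (b ∷ w) n = trans (tword-sub (tmap 2 u (toℕ b)) w n) (cong u (regroup (toℕ b) (num w) (2 ^ length w) n))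
  where
  regroup : ∀ b w k n → 2 * (k * n + w) + b ≡ 2 * k * n + (b + 2 * w)
  regroup = solve-∀

-- _≈ˢ_ wrapped in a record, so that Agda can infer the two sequences.
infix 4 _≋_
record _≋_ {Δ : Set} (u v : Seq Δ) : Set where
  constructor mk≋
  field ≋⇒≈ˢ : u ≈ˢ v
open _≋_ public

≋-setoid : Set → Setoid 0ℓ 0ℓ
≋-setoid Δ = record
  { Carrier       = Seq Δ
  ; _≈_           = _≋_
  ; isEquivalence = record
    { refl  = mk≋ λ n → refl
    ; sym   = λ (mk≋ e) → mk≋ λ n → sym (e n)
    ; trans = λ (mk≋ e) (mk≋ f) → mk≋ λ n → trans (e n) (f n)
    }
  }

module _ {Δ : Set} where
  open Setoid (≋-setoid Δ) public using () renaming (refl to ≋-refl; sym to ≋-sym; trans to ≋-trans; reflexive to ≡⇒≋)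

module ≋-Reasoning {Δ : Set} = SetoidReasoning (≋-setoid Δ)

≋-at : ∀ {Δ} {u v : Seq Δ} → u ≋ v → ∀ {n} → 0 < n → u n ≡ v n
≋-at e {suc n} _ = ≋⇒≈ˢ e n

tword-cong : ∀ {Δ} {u v : Seq Δ} w → u ≋ v → tword 2 u w ≋ tword 2 v w
tword-cong {u = u} {v} w u≋v = mk≋ λ m → begin
  tword 2 u w (suc m)                  ≡⟨ tword-sub u w (suc m) ⟩
  u (2 ^ length w * suc m + num w)     ≡⟨ ≋-at u≋v (≤-trans (*-mono-≤ (m^n>0 2 (length w)) (s≤s z≤n)) (m≤m+n _ (num w))) ⟩
  v (2 ^ length w * suc m + num w)     ≡⟨ tword-sub v w (suc m) ⟨
  tword 2 v w (suc m)                  ∎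
  where open ≡-Reasoning

tword-++ : ∀ {Δ} (u : Seq Δ) w x → tword 2 u (w ++ x) ≡ tword 2 (tword 2 u w) x
tword-++ u w x = foldl-++ _ u w x

sub-tword : ∀ {Δ} (u : Seq Δ) w → sub 2 u (length w) (num w) ≋ tword 2 u w
sub-tword u w = mk≋ λ m → sym (tword-sub u w (suc m))

iterate-+ : ∀ {A : Set} (f : A → A) x m n → iterate f x (m + n) ≡ iterate f (iterate f x m) n
iterate-+ f x zero    n = refl
iterate-+ f x (suc m) n = iterate-+ f (f x) m n

iterate-fixed-∣ : ∀ {A : Set} (f : A → A) {x p n} → iterate f x p ≡ x → p ∣ n → iterate f x n ≡ x
iterate-fixed-∣ f {x} {p} fixed (divides c refl) = go c
  where
  go : ∀ c → iterate f x (c * p) ≡ x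
  go zero    = refl
  go (suc c) = trans (iterate-+ f x p (c * p)) (trans (cong (λ y → iterate f y (c * p)) fixed) (go c))

m∣n! : ∀ {m n} → 0 < m → m ≤ n → m ∣ n !
m∣n! {suc m} _ m≤n = ∣-trans (divides (m !) (*-comm (suc m) (m !))) (m≤n⇒m!∣n! m≤n)

-- Pigeonhole: some x, f x, …, fⁿ x coincide, so fⁿ x lies on a cycle whose length divides n!.
iterate-eventually-periodic : ∀ {n} (f : Fin n → Fin n) x → iterate f x (n + n !) ≡ iterate f x n
iterate-eventually-periodic {n} f x
  with i , j , i<j , fⁱx≡fʲx ← pigeonhole (n<1+n n) (λ k → iterate f x (toℕ k))
  = trans (iterate-+ f x n (n !)) (iterate-fixed-∣ f on-cycle (m∣n! (m<n⇒0<n∸m i<j) p≤n))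
  where
  open ≡-Reasoning
  a = toℕ i
  b = toℕ j
  p = b ∸ a
  b≤n : b ≤ n
  b≤n = ≤-pred (toℕ<n j)
  p≤n : p ≤ n
  p≤n = ≤-trans (m∸n≤m b a) b≤n
  n+p≡b+[n∸a] : n + p ≡ b + (n ∸ a)
  n+p≡b+[n∸a] = begin
    n + (b ∸ a)    ≡⟨ +-∸-assoc n (<⇒≤ i<j) ⟨
    n + b ∸ a      ≡⟨ cong (_∸ a) (+-comm n b) ⟩
    b + n ∸ a      ≡⟨ +-∸-assoc b (≤-trans (<⇒≤ i<j) b≤n) ⟩
    b + (n ∸ a)    ∎
  on-cycle : iterate f (iterate f x n) p ≡ iterate f x n
  on-cycle = begin
    iterate f (iterate f x n) p              ≡⟨ iterate-+ f x n p ⟨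
    iterate f x (n + p)                      ≡⟨ cong (iterate f x) n+p≡b+[n∸a] ⟩
    iterate f x (b + (n ∸ a))                ≡⟨ iterate-+ f x b (n ∸ a) ⟩
    iterate f (iterate f x b) (n ∸ a)        ≡⟨ cong (λ y → iterate f y (n ∸ a)) fⁱx≡fʲx ⟨
    iterate f (iterate f x a) (n ∸ a)        ≡⟨ iterate-+ f x a (n ∸ a) ⟨
    iterate f x (a + (n ∸ a))                ≡⟨ cong (iterate f x) (m+[n∸m]≡n (≤-trans (<⇒≤ i<j) b≤n)) ⟩
    iterate f x n                            ∎

injective⇒surjective : ∀ {n} (f : Fin n → Fin n) → Injective _≡_ _≡_ f → ∀ i → ∃ λ j → f j ≡ i
injective⇒surjective {suc n} f injective i with any? (λ j → f j ≟ᶠ i)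
... | yes found = found
... | no ¬found = contradiction (injective⇒≤ avoid-i-injective) 1+n≰n
  where
  f≢i : ∀ j → f j ≢ i
  f≢i j fj≡i = ¬found (j , fj≡i)
  avoid-i : Fin (suc n) → Fin n
  avoid-i j = punchOut (f≢i j ∘ sym)
  avoid-i-injective : Injective _≡_ _≡_ avoid-i
  avoid-i-injective {x} {y} e = injective (punchOut-injective (f≢i x ∘ sym) (f≢i y ∘ sym) e)

InN-self : ∀ {Δ} (a : Seq Δ) → InN 2 a a
InN-self a = 0 , 0 , s≤s z≤n , λ n → cong a (sym (trans (+-identityʳ _) (+-identityʳ (suc n))))

-- A relation (i , j) of type r says u = u^{t_V t_r} where j = num (V ∷ʳ r).
globalRelation⇒section : ∀ {Δ} (a : Seq Δ) (r : Fin 2) {i j} → IsGlobalRelation 2 a i j → relType 2 i j ≡ toℕ r →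
  ∃ λ V → ∀ u → InN 2 a u → tmap 2 (tword 2 u V) (toℕ r) ≋ u
globalRelation⇒section a r {zero} global _ with j<1 , nontrivial , _ ← global a (InN-self a)
  = ⊥-elim (nontrivial (refl , n<1⇒n≡0 j<1))
globalRelation⇒section a r {suc i} {j} global type = V , V-section
  where
  instance _ = m^n≢0 2 i
  V = digits i (j % 2 ^ i)
  length-V∷ʳr : length (V ∷ʳ r) ≡ suc i
  length-V∷ʳr = trans (length-++ V) (trans (cong (_+ 1) (length-digits i _)) (+-comm i 1))
  num-V∷ʳr : num (V ∷ʳ r) ≡ j
  num-V∷ʳr = begin
    num (V ∷ʳ r)                    ≡⟨ num-∷ʳ V r ⟩
    num V + 2 ^ length V * toℕ r    ≡⟨ cong₂ (λ x i → x + 2 ^ i * toℕ r) (num-digits i _ (m%n<n j _)) (length-digits i _) ⟩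
    j % 2 ^ i + 2 ^ i * toℕ r       ≡⟨ cong (λ x → j % 2 ^ i + 2 ^ i * x) type ⟨
    j % 2 ^ i + 2 ^ i * (j / 2 ^ i) ≡⟨ cong (j % 2 ^ i +_) (*-comm (2 ^ i) _) ⟩
    j % 2 ^ i + j / 2 ^ i * 2 ^ i   ≡⟨ m≡m%n+[m/n]*n j (2 ^ i) ⟨
    j                               ∎
    where open ≡-Reasoning
  V-section : ∀ u → InN 2 a u → tmap 2 (tword 2 u V) (toℕ r) ≋ u
  V-section u u∈N with _ , _ , relation ← global u u∈N = begin
    tmap 2 (tword 2 u V) (toℕ r)              ≡⟨ tword-++ u V [ r ] ⟨
    tword 2 u (V ∷ʳ r)                        ≈⟨ sub-tword u (V ∷ʳ r) ⟨
    sub 2 u (length (V ∷ʳ r)) (num (V ∷ʳ r))  ≡⟨ cong₂ (sub 2 u) length-V∷ʳr num-V∷ʳr ⟩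
    sub 2 u (suc i) j                         ≈⟨ mk≋ relation ⟩
    u                                         ∎
    where open ≋-Reasoning

module _ {Δ : Set} (a : Seq Δ) (r : Fin 2) where

  Periodic : ℕ → Set
  Periodic P = ∀ u → InN 2 a u → tword 2 u (replicate P r) ≋ u

  TInjective : Set
  TInjective = ∀ u v → InN 2 a u → InN 2 a v → tmap 2 u (toℕ r) ≈ˢ tmap 2 v (toℕ r) → u ≈ˢ v

  periodic⇒injective : ∀ {P} → 0 < P → Periodic P → TInjective
  periodic⇒injective {suc P} _ periodic u v u∈N v∈N tᵣu≈tᵣv = ≋⇒≈ˢ (begin
    u                                           ≈⟨ periodic u u∈N ⟨
    tword 2 (tmap 2 u (toℕ r)) (replicate P r)  ≈⟨ tword-cong (replicate P r) (mk≋ tᵣu≈tᵣv) ⟩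
    tword 2 (tmap 2 v (toℕ r)) (replicate P r)  ≈⟨ periodic v v∈N ⟩
    v                                           ∎)
    where open ≋-Reasoning

  periodic⇒globalRelation : ∀ {P} → 0 < P → Periodic P →
    IsGlobalRelation 2 a P (num (replicate P r)) × relType 2 P (num (replicate P r)) ≡ toℕ r
  periodic⇒globalRelation {P@(suc P′)} _ periodic = global , type
    where
    w = replicate P r
    length-w : length w ≡ P
    length-w = length-replicate P
    global : IsGlobalRelation 2 a P (num w)
    global u u∈N = subst (λ i → num w < 2 ^ i) length-w (num<2^length w)
                 , (λ ())
                 , ≋⇒≈ˢ (≋-trans (≡⇒≋ (cong (λ i → sub 2 u i (num w)) (sym length-w)))
                                 (≋-trans (sub-tword u w) (periodic u u∈N)))
    type : relType 2 P (num w) ≡ toℕ r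
    type = begin
      relType 2 P (num w)                 ≡⟨ /-congˡ (cong num (replicate-∷ʳ P′ r)) ⟩
      num (replicate P′ r ∷ʳ r) / 2 ^ P′  ≡⟨ num-∷ʳ/2^length (replicate P′ r) r (length-replicate P′) ⟩
      toℕ r                               ∎
      where
      open ≡-Reasoning
      instance _ = m^n≢0 2 P′

module Pumping {X : Set} {m : ℕ} (encode : X → Fin m) (encode-injective : Injective _≡_ _≡_ encode)
               (δ : X → Fin 2 → X) where

  cut-loop : ∀ x v → m ≤ length v → ∃ λ v′ → length v′ < length v × foldl δ x v′ ≡ foldl δ x v
  cut-loop x v m≤∣v∣ with i , j , i<j , same ← pigeonhole (n<1+n m) (λ k → encode (foldl δ x (take (toℕ k) v)))
    = take (toℕ i) v ++ drop (toℕ j) v , shorter , same-end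
    where
    j≤∣v∣ : toℕ j ≤ length v
    j≤∣v∣ = ≤-trans (≤-pred (toℕ<n j)) m≤∣v∣
    length-take-i : length (take (toℕ i) v) ≡ toℕ i
    length-take-i = trans (length-take (toℕ i) v) (m≤n⇒m⊓n≡m (≤-trans (<⇒≤ i<j) j≤∣v∣))
    shorter : length (take (toℕ i) v ++ drop (toℕ j) v) < length v
    shorter = begin-strict
      length (take (toℕ i) v ++ drop (toℕ j) v)          ≡⟨ length-++ (take (toℕ i) v) ⟩
      length (take (toℕ i) v) + length (drop (toℕ j) v)  ≡⟨ cong₂ _+_ length-take-i (length-drop (toℕ j) v) ⟩
      toℕ i + (length v ∸ toℕ j)                         <⟨ +-monoˡ-< (length v ∸ toℕ j) i<j ⟩
      toℕ j + (length v ∸ toℕ j)                         ≡⟨ m+[n∸m]≡n j≤∣v∣ ⟩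
      length v                                           ∎
      where open ≤-Reasoning
    same-end : foldl δ x (take (toℕ i) v ++ drop (toℕ j) v) ≡ foldl δ x v
    same-end = begin
      foldl δ x (take (toℕ i) v ++ drop (toℕ j) v)               ≡⟨ foldl-++ δ x (take (toℕ i) v) _ ⟩
      foldl δ (foldl δ x (take (toℕ i) v)) (drop (toℕ j) v)      ≡⟨ cong (λ y → foldl δ y (drop (toℕ j) v)) (encode-injective same) ⟩
      foldl δ (foldl δ x (take (toℕ j) v)) (drop (toℕ j) v)      ≡⟨ foldl-++ δ x (take (toℕ j) v) _ ⟨
      foldl δ x (take (toℕ j) v ++ drop (toℕ j) v)               ≡⟨ cong (foldl δ x) (take++drop≡id (toℕ j) v) ⟩
      foldl δ x v                                                ∎
      where open ≡-Reasoning

  shorten : ∀ x v → ∃ λ v′ → length v′ < m × foldl δ x v′ ≡ foldl δ x v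
  shorten x v = go (length v) x v ≤-refl
    where
    go : ∀ fuel x v → length v ≤ fuel → ∃ λ v′ → length v′ < m × foldl δ x v′ ≡ foldl δ x v
    go fuel x v ∣v∣≤fuel with length v <? m
    ... | yes ∣v∣<m = v , ∣v∣<m , refl
    go zero x v ∣v∣≤0 | no ∣v∣≮m =
      ⊥-elim (∣v∣≮m (subst (_< m) (sym (n≤0⇒n≡0 ∣v∣≤0)) (≤-trans (s≤s z≤n) (toℕ<n (encode x)))))
    go (suc fuel) x v ∣v∣≤fuel | no ∣v∣≮m with v′ , shorter , same ← cut-loop x v (≮⇒≥ ∣v∣≮m)
      with v″ , short , same′ ← go fuel x v′ (≤-pred (≤-trans shorter ∣v∣≤fuel))
      = v″ , short , trans same′ same

words< : ℕ → List Word
words< zero    = []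
words< (suc k) = [] ∷ map (0F ∷_) (words< k) ++ map (1F ∷_) (words< k)

∈-words< : ∀ {k} v → length v < k → v ∈ words< k
∈-words< {suc k} []       _          = here refl
∈-words< {suc k} (0F ∷ v) (s≤s ∣v∣<k) = there (∈-++⁺ˡ (∈-map⁺ (0F ∷_) (∈-words< v ∣v∣<k)))
∈-words< {suc k} (1F ∷ v) (s≤s ∣v∣<k) = there (∈-++⁺ʳ _ (∈-map⁺ (1F ∷_) (∈-words< v ∣v∣<k)))

module Deduplication {X : Set} (_~_ : X → X → Set) (~-refl : ∀ {x} → x ~ x) (~-sym : ∀ {x y} → x ~ y → y ~ x)
                       (_~?_ : ∀ x y → Dec (x ~ y)) where

  record Representatives (xs : List X) : Set where
    field
      reps     : List X
      distinct : ∀ i j → lookup reps i ~ lookup reps j → i ≡ j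
      cover    : ∀ {x} → x ∈ xs → ∃ λ i → x ~ lookup reps i

  representatives : ∀ xs → Representatives xs
  representatives []       = record { reps = [] ; distinct = λ () ; cover = λ () }
  representatives (x ∷ xs) with R ← representatives xs | any? (λ i → x ~? lookup (Representatives.reps R) i)
  ... | yes (i , x~rᵢ) = record { reps = reps ; distinct = distinct ; cover = cover′ }
    where
    open Representatives R
    cover′ : ∀ {y} → y ∈ x ∷ xs → ∃ λ i → y ~ lookup reps i
    cover′ (here refl) = i , x~rᵢ
    cover′ (there y∈)  = cover y∈
  ... | no x≁reps = record { reps = x ∷ reps ; distinct = distinct′ ; cover = cover′ }
    where
    open Representatives R
    distinct′ : ∀ i j → lookup (x ∷ reps) i ~ lookup (x ∷ reps) j → i ≡ j
    distinct′ 0F       0F       _     = refl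
    distinct′ 0F       (fsuc j) x~rⱼ  = ⊥-elim (x≁reps (j , x~rⱼ))
    distinct′ (fsuc i) 0F       rᵢ~x  = ⊥-elim (x≁reps (i , ~-sym rᵢ~x))
    distinct′ (fsuc i) (fsuc j) rᵢ~rⱼ = cong fsuc (distinct i j rᵢ~rⱼ)
    cover′ : ∀ {y} → y ∈ x ∷ xs → ∃ λ i → y ~ lookup (x ∷ reps) i
    cover′ (here refl) = 0F , ~-refl
    cover′ (there y∈)  = let (i , y~rᵢ) = cover y∈ in fsuc i , y~rᵢ

module PermutationSchreier {p k : ℕ} (σ σ⁻¹ : Fin p → Fin k → Fin k)
       (σ⁻¹-σ : ∀ b i → σ⁻¹ b (σ b i) ≡ i) (σ-σ⁻¹ : ∀ b i → σ b (σ⁻¹ b i) ≡ i) where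

  SignedWord : Set
  SignedWord = List (Fin p × Bool)

  step : Fin k → Fin p × Bool → Fin k
  step i (b , false) = σ b i
  step i (b , true)  = σ⁻¹ b i

  infixl 5 _⊙_
  _⊙_ : Fin k → SignedWord → Fin k
  i ⊙ g = foldl step i g

  ⊙-++ : ∀ i g h → i ⊙ (g ++ h) ≡ i ⊙ g ⊙ h
  ⊙-++ i g h = foldl-++ step i g h

  ⊙-positive : ∀ i w → i ⊙ map (_, false) w ≡ foldl (λ j b → σ b j) i w
  ⊙-positive i w = foldl-map step (_, false) i w

  flip-sign : Fin p × Bool → Fin p × Bool
  flip-sign (b , s) = b , not s

  invert : SignedWord → SignedWord
  invert []      = []
  invert (x ∷ g) = invert g ∷ʳ flip-sign x

  step-flip : ∀ x i → step (step i x) (flip-sign x) ≡ i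
  step-flip (b , false) i = σ⁻¹-σ b i
  step-flip (b , true)  i = σ-σ⁻¹ b i

  flip-step : ∀ x i → step (step i (flip-sign x)) x ≡ i
  flip-step (b , false) i = σ-σ⁻¹ b i
  flip-step (b , true)  i = σ⁻¹-σ b i

  ⊙-invertʳ : ∀ g i → i ⊙ (g ++ invert g) ≡ i
  ⊙-invertʳ []      i = refl
  ⊙-invertʳ (x ∷ g) i = begin
    step i x ⊙ (g ++ invert g ∷ʳ flip-sign x)        ≡⟨ cong (step i x ⊙_) (++-assoc g (invert g) _) ⟨
    step i x ⊙ ((g ++ invert g) ∷ʳ flip-sign x)      ≡⟨ ⊙-++ (step i x) (g ++ invert g) _ ⟩
    step (step i x ⊙ (g ++ invert g)) (flip-sign x)  ≡⟨ cong (λ j → step j (flip-sign x)) (⊙-invertʳ g (step i x)) ⟩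
    step (step i x) (flip-sign x)                    ≡⟨ step-flip x i ⟩
    i                                                ∎
    where open ≡-Reasoning

  ⊙-invertˡ : ∀ g i → i ⊙ (invert g ++ g) ≡ i
  ⊙-invertˡ []      i = refl
  ⊙-invertˡ (x ∷ g) i = begin
    i ⊙ ((invert g ∷ʳ flip-sign x) ++ x ∷ g)        ≡⟨ cong (i ⊙_) (++-assoc (invert g) _ (x ∷ g)) ⟩
    i ⊙ (invert g ++ flip-sign x ∷ x ∷ g)           ≡⟨ ⊙-++ i (invert g) _ ⟩
    step (step (i ⊙ invert g) (flip-sign x)) x ⊙ g  ≡⟨ cong (_⊙ g) (flip-step x (i ⊙ invert g)) ⟩
    i ⊙ invert g ⊙ g                                ≡⟨ ⊙-++ i (invert g) g ⟨
    i ⊙ (invert g ++ g)                             ≡⟨ ⊙-invertˡ g i ⟩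
    i                                               ∎
    where open ≡-Reasoning

  infix 4 _≃_
  _≃_ : SignedWord → SignedWord → Set
  g ≃ h = ∀ i → i ⊙ g ≡ i ⊙ h

  invert-cong : ∀ {g h} → g ≃ h → invert g ≃ invert h
  invert-cong {g} {h} g≃h i = begin
    i ⊙ invert g                    ≡⟨ ⊙-invertʳ h (i ⊙ invert g) ⟨
    i ⊙ invert g ⊙ (h ++ invert h)  ≡⟨ ⊙-++ (i ⊙ invert g) h (invert h) ⟩
    i ⊙ invert g ⊙ h ⊙ invert h     ≡⟨ cong (_⊙ invert h) (g≃h (i ⊙ invert g)) ⟨
    i ⊙ invert g ⊙ g ⊙ invert h     ≡⟨ cong (_⊙ invert h) (trans (sym (⊙-++ i (invert g) g)) (⊙-invertˡ g i)) ⟩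
    i ⊙ invert h                    ∎
    where open ≡-Reasoning

  -- Signed words up to their action on Fin k, so that the action is faithful by construction.
  group : Group 0ℓ 0ℓ
  group = record
    { Carrier = SignedWord
    ; _≈_     = _≃_
    ; _∙_     = _++_
    ; ε       = []
    ; _⁻¹     = invert
    ; isGroup = record
      { isMonoid = record
        { isSemigroup = record
          { isMagma = record
            { isEquivalence = record { refl = λ i → refl ; sym = λ e i → sym (e i) ; trans = λ e f i → trans (e i) (f i) }
            ; ∙-cong = λ {g} {g′} {h} {h′} g≃g′ h≃h′ i →
                trans (⊙-++ i g h) (trans (cong (_⊙ h) (g≃g′ i)) (trans (h≃h′ (i ⊙ g′)) (sym (⊙-++ i g′ h′))))
            }
          ; assoc = λ g h l i → cong (i ⊙_) (++-assoc g h l)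
          }
        ; identity = (λ g i → refl) , (λ g i → cong (i ⊙_) (++-identityʳ g))
        }
      ; inverse = ⊙-invertˡ , ⊙-invertʳ
      ; ⁻¹-cong = λ {g} {h} → invert-cong {g} {h}
      }
    }

  generator : Fin p → SignedWord
  generator b = [ (b , false) ]

  evalGroupWord≃ : ∀ g → evalGroupWord group generator g ≃ g
  evalGroupWord≃ []               i = refl
  evalGroupWord≃ ((b , false) ∷ g) i = evalGroupWord≃ g (σ b i)
  evalGroupWord≃ ((b , true)  ∷ g) i = evalGroupWord≃ g (σ⁻¹ b i)

  schreierAutomaton : ∀ {Δ : Set} (x₀ : Fin k) → (∀ i → ∃ λ g → x₀ ⊙ g ≡ i) → (Fin k → Δ) → SchreierAutomaton p Δ
  schreierAutomaton x₀ reach label = record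
    { G          = group
    ; t          = generator
    ; generates  = λ g → g , evalGroupWord≃ g
    ; nQ         = k
    ; act        = _⊙_
    ; act-cong   = λ i g≃h → g≃h i
    ; act-ε      = λ i → refl
    ; act-∙      = ⊙-++
    ; faithful   = λ g h same → same
    ; transitive = transitive
    ; q₀         = x₀
    ; τ          = label
    }
    where
    transitive : ∀ i j → ∃ λ g → i ⊙ g ≡ j
    transitive i j = let (gᵢ , x₀gᵢ≡i) = reach i ; (gⱼ , x₀gⱼ≡j) = reach j in
      invert gᵢ ++ gⱼ , (begin
      i ⊙ (invert gᵢ ++ gⱼ)       ≡⟨ ⊙-++ i (invert gᵢ) gⱼ ⟩
      i ⊙ invert gᵢ ⊙ gⱼ          ≡⟨ cong (λ j → j ⊙ invert gᵢ ⊙ gⱼ) x₀gᵢ≡i ⟨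
      x₀ ⊙ gᵢ ⊙ invert gᵢ ⊙ gⱼ    ≡⟨ cong (_⊙ gⱼ) (trans (sym (⊙-++ x₀ gᵢ (invert gᵢ))) (⊙-invertʳ gᵢ x₀)) ⟩
      x₀ ⊙ gⱼ                     ≡⟨ x₀gⱼ≡j ⟩
      j                           ∎)
      where open ≡-Reasoning

module Kernel {Δ : Set} (A : Automaton 2 Δ) (a : Seq Δ) (produces : Produces A a) where
  open Automaton A

  infixl 5 _·_
  _·_ : Fin nQ → Word → Fin nQ
  q · w = foldl δ q w

  ⟦_⟧ : Fin nQ → Seq Δ
  ⟦ q ⟧ n = τ (q · bits n)

  a≋⟦q₀⟧ : a ≋ ⟦ q₀ ⟧
  a≋⟦q₀⟧ = mk≋ λ m → trans (produces m) (cong τ (runF≡foldl-binary δ (suc m) q₀ (suc m)))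

  tword-⟦⟧ : ∀ q w → tword 2 ⟦ q ⟧ w ≋ ⟦ q · w ⟧
  tword-⟦⟧ q w = mk≋ λ m → begin
    tword 2 ⟦ q ⟧ w (suc m)                       ≡⟨ tword-sub ⟦ q ⟧ w (suc m) ⟩
    τ (q · bits (2 ^ length w * suc m + num w))   ≡⟨ cong (λ v → τ (q · v)) (bits-++ w m) ⟩
    τ (q · (w ++ bits (suc m)))                   ≡⟨ cong τ (foldl-++ δ q w (bits (suc m))) ⟩
    ⟦ q · w ⟧ (suc m)                             ∎
    where open ≡-Reasoning

  tword-a : ∀ w → tword 2 a w ≋ ⟦ q₀ · w ⟧
  tword-a w = ≋-trans (tword-cong w a≋⟦q₀⟧) (tword-⟦⟧ q₀ w)

  InN⇒reachable : ∀ u → InN 2 a u → ∃ λ w → u ≋ ⟦ q₀ · w ⟧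
  InN⇒reachable u (i , j , j<2^i , u≈aⁱʲ) = digits i j , (begin
    u                                         ≈⟨ mk≋ u≈aⁱʲ ⟩
    sub 2 a i j                               ≡⟨ cong₂ (sub 2 a) (length-digits i j) (num-digits i j j<2^i) ⟨
    sub 2 a (length (digits i j)) (num (digits i j))  ≈⟨ sub-tword a (digits i j) ⟩
    tword 2 a (digits i j)                    ≈⟨ tword-a (digits i j) ⟩
    ⟦ q₀ · digits i j ⟧                       ∎)
    where open ≋-Reasoning

  reachable∈N : ∀ w → InN 2 a ⟦ q₀ · w ⟧
  reachable∈N w = length w , num w , num<2^length w , ≋⇒≈ˢ (≋-sym (≋-trans (sub-tword a w) (tword-a w)))

  InN-resp : ∀ {u v} → u ≋ v → InN 2 a u → InN 2 a v
  InN-resp u≋v (i , j , j<2^i , u≈aⁱʲ) = i , j , j<2^i , ≋⇒≈ˢ (≋-trans (≋-sym u≋v) (mk≋ {v = sub 2 a i j} u≈aⁱʲ))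

  InN-tword : ∀ {u} w → InN 2 a u → InN 2 a (tword 2 u w)
  InN-tword {u} w u∈N with w₀ , u≋ ← InN⇒reachable u u∈N =
    InN-resp (≋-sym (≋-trans (tword-cong w u≋) (≋-trans (tword-⟦⟧ _ w) (≡⇒≋ (cong ⟦_⟧ (sym (foldl-++ δ q₀ w₀ w)))))))
             (reachable∈N (w₀ ++ w))

  ⟦⟧≋⇔τ-∷ʳ1 : ∀ {q q′} → ⟦ q ⟧ ≋ ⟦ q′ ⟧ ⇔ (∀ v → τ (q · (v ∷ʳ 1F)) ≡ τ (q′ · (v ∷ʳ 1F)))
  ⟦⟧≋⇔τ-∷ʳ1 {q} {q′} = mk⇔
    (λ q≋q′ v → begin
      τ (q · (v ∷ʳ 1F))            ≡⟨ cong (λ w → τ (q · w)) (bits-num v) ⟨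
      ⟦ q ⟧ (num (v ∷ʳ 1F))        ≡⟨ ≋-at q≋q′ (num-∷ʳ1>0 v) ⟩
      ⟦ q′ ⟧ (num (v ∷ʳ 1F))       ≡⟨ cong (λ w → τ (q′ · w)) (bits-num v) ⟩
      τ (q′ · (v ∷ʳ 1F))           ∎)
    (λ agree → mk≋ λ m → let (v , bits≡ , _) = bits-suc m in begin
      τ (q · bits (suc m))         ≡⟨ cong (λ w → τ (q · w)) bits≡ ⟩
      τ (q · (v ∷ʳ 1F))            ≡⟨ agree v ⟩
      τ (q′ · (v ∷ʳ 1F))           ≡⟨ cong (λ w → τ (q′ · w)) bits≡ ⟨
      τ (q′ · bits (suc m))        ∎)
    where open ≡-Reasoning

  ⟦⟧-∷ʳ : ∀ q w b → ⟦ q · (w ∷ʳ b) ⟧ ≋ tmap 2 ⟦ q · w ⟧ (toℕ b)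
  ⟦⟧-∷ʳ q w b = ≋-trans (≡⇒≋ (cong ⟦_⟧ (foldl-∷ʳ δ q b w))) (≋-sym (tword-⟦⟧ (q · w) [ b ]))

  P′ : ℕ
  P′ = pred (nQ !)

  replicate-nQ! : ∀ (r : Fin 2) → r ∷ replicate P′ r ≡ replicate (nQ !) r
  replicate-nQ! r = cong (λ k → replicate k r) (suc-pred (nQ !) {{nQ !≢0}})

  ·-replicate : ∀ q k r → q · replicate k r ≡ iterate (λ x → δ x r) q k
  ·-replicate q zero    r = refl
  ·-replicate q (suc k) r = ·-replicate (δ q r) k r

  ·-replicate-eventually-periodic : ∀ r q → q · replicate (nQ + nQ !) r ≡ q · replicate nQ r
  ·-replicate-eventually-periodic r q = begin
    q · replicate (nQ + nQ !) r              ≡⟨ ·-replicate q (nQ + nQ !) r ⟩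
    iterate (λ x → δ x r) q (nQ + nQ !)      ≡⟨ iterate-eventually-periodic (λ x → δ x r) q ⟩
    iterate (λ x → δ x r) q nQ               ≡⟨ ·-replicate q nQ r ⟨
    q · replicate nQ r                       ∎
    where open ≡-Reasoning

  tword-replicate-eventually-periodic : ∀ r {u} → InN 2 a u →
    tword 2 u (replicate (nQ + nQ !) r) ≋ tword 2 u (replicate nQ r)
  tword-replicate-eventually-periodic r {u} u∈N with w , u≋ ← InN⇒reachable u u∈N = begin
    tword 2 u long          ≈⟨ tword-cong long u≋ ⟩
    tword 2 ⟦ q ⟧ long      ≈⟨ tword-⟦⟧ q long ⟩
    ⟦ q · long ⟧            ≡⟨ cong ⟦_⟧ (·-replicate-eventually-periodic r q) ⟩
    ⟦ q · short ⟧           ≈⟨ tword-⟦⟧ q short ⟨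
    tword 2 ⟦ q ⟧ short     ≈⟨ tword-cong short u≋ ⟨
    tword 2 u short         ∎
    where
    open ≋-Reasoning
    q = q₀ · w
    long = replicate (nQ + nQ !) r
    short = replicate nQ r

  cancel-replicate : ∀ r → TInjective a r → ∀ k {u v} → InN 2 a u → InN 2 a v →
    tword 2 u (replicate k r) ≋ tword 2 v (replicate k r) → u ≋ v
  cancel-replicate r injective zero    _   _   e = e
  cancel-replicate r injective (suc k) {u} {v} u∈N v∈N e = mk≋ (injective u v u∈N v∈N
    (≋⇒≈ˢ (cancel-replicate r injective k (InN-tword {u} [ r ] u∈N) (InN-tword {v} [ r ] v∈N) e)))

  injective⇒periodic : ∀ r → TInjective a r → Periodic a r (nQ !)
  injective⇒periodic r injective u u∈N = cancel-replicate r injective nQ (InN-tword period u∈N) u∈N (begin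
    tword 2 (tword 2 u period) short      ≡⟨ tword-++ u period short ⟨
    tword 2 u (period ++ short)           ≡⟨ cong (tword 2 u) (replicate-+ (nQ !) nQ r) ⟨
    tword 2 u (replicate (nQ ! + nQ) r)   ≡⟨ cong (λ k → tword 2 u (replicate k r)) (+-comm (nQ !) nQ) ⟩
    tword 2 u (replicate (nQ + nQ !) r)   ≈⟨ tword-replicate-eventually-periodic r u∈N ⟩
    tword 2 u short                       ∎)
    where
    open ≋-Reasoning
    period = replicate (nQ !) r
    short = replicate nQ r

  -- u = (preᵏ u)^{t_r^k} for every k, and t_r^{nQ} = t_r^{nQ + nQ !} on N(a).
  section⇒periodic : ∀ r (pre : Seq Δ → Seq Δ) → (∀ {u} → InN 2 a u → InN 2 a (pre u)) →
    (∀ u → InN 2 a u → tmap 2 (pre u) (toℕ r) ≋ u) → Periodic a r (nQ !)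
  section⇒periodic r pre pre∈N section u u∈N = begin
    tword 2 u period                          ≈⟨ tword-cong period (u≋ nQ) ⟩
    tword 2 (tword 2 x short) period          ≡⟨ tword-++ x short period ⟨
    tword 2 x (short ++ period)               ≡⟨ cong (tword 2 x) (replicate-+ nQ (nQ !) r) ⟨
    tword 2 x (replicate (nQ + nQ !) r)       ≈⟨ tword-replicate-eventually-periodic r (preᵏ∈N nQ) ⟩
    tword 2 x short                           ≈⟨ u≋ nQ ⟨
    u                                         ∎
    where
    open ≋-Reasoning
    period = replicate (nQ !) r
    short = replicate nQ r
    preᵏ∈N : ∀ k → InN 2 a (fold u pre k)
    preᵏ∈N zero    = u∈N
    preᵏ∈N (suc k) = pre∈N (preᵏ∈N k)
    u≋ : ∀ k → u ≋ tword 2 (fold u pre k) (replicate k r)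
    u≋ zero    = ≋-refl
    u≋ (suc k) = ≋-trans (u≋ k) (tword-cong (replicate k r) (≋-sym (section _ (preᵏ∈N k))))
    x = fold u pre nQ

  globalRelations⇒group : GlobalRelationsOfAllTypes 2 a → GIsGroup 2 a
  globalRelations⇒group relations r
    with i , j , global , type ← relations (toℕ r) (toℕ<n r)
    with V , V-section ← globalRelation⇒section a r global type
    = periodic⇒injective a r (1≤n! nQ) (section⇒periodic r (λ u → tword 2 u V) (InN-tword V) V-section)
    , λ v v∈N → tword 2 v V , InN-tword V v∈N , ≋⇒≈ˢ (V-section v v∈N)

module Schreier {Δ : Set} (S : SchreierAutomaton 2 Δ) (a : Seq Δ)
                (produces : Produces (SchreierAutomaton.automaton S) a) where
  open SchreierAutomaton S
  open Group G using (inverseˡ; inverseʳ) renaming (sym to ≈-sym)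
  open Kernel automaton a produces public

  ⟨_⟩ : Word → Carrier
  ⟨ []    ⟩ = ε
  ⟨ b ∷ w ⟩ = t b ∙ ⟨ w ⟩

  act-⟨⟩ : ∀ q w → act q ⟨ w ⟩ ≡ q · w
  act-⟨⟩ q []      = act-ε q
  act-⟨⟩ q (b ∷ w) = trans (act-∙ q (t b) ⟨ w ⟩) (act-⟨⟩ (act q (t b)) w)

  act-act⁻¹ : ∀ q g → act (act q g) (g ⁻¹) ≡ q
  act-act⁻¹ q g = trans (sym (act-∙ q g (g ⁻¹))) (trans (act-cong q (inverseʳ g)) (act-ε q))

  act⁻¹-act : ∀ q g → act (act q (g ⁻¹)) g ≡ q
  act⁻¹-act q g = trans (sym (act-∙ q (g ⁻¹) g)) (trans (act-cong q (inverseˡ g)) (act-ε q))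

  act-injective : ∀ g {q q′} → act q g ≡ act q′ g → q ≡ q′
  act-injective g {q} {q′} e = trans (sym (act-act⁻¹ q g)) (trans (cong (λ x → act x (g ⁻¹)) e) (act-act⁻¹ q′ g))

  ·-replicate-injective : ∀ r k {q q′} → q · replicate k r ≡ q′ · replicate k r → q ≡ q′
  ·-replicate-injective r zero    e = e
  ·-replicate-injective r (suc k) e = act-injective (t r) (·-replicate-injective r k e)

  ·-replicate-periodic : ∀ r q → q · replicate (nQ !) r ≡ q
  ·-replicate-periodic r q = ·-replicate-injective r nQ (begin
    q · replicate (nQ !) r · replicate nQ r     ≡⟨ foldl-++ _ q (replicate (nQ !) r) (replicate nQ r) ⟨
    q · (replicate (nQ !) r ++ replicate nQ r)  ≡⟨ cong (q ·_) (replicate-+ (nQ !) nQ r) ⟨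
    q · replicate (nQ ! + nQ) r                 ≡⟨ cong (λ k → q · replicate k r) (+-comm (nQ !) nQ) ⟩
    q · replicate (nQ + nQ !) r                 ≡⟨ ·-replicate-eventually-periodic r q ⟩
    q · replicate nQ r                          ∎)
    where open ≡-Reasoning

  ·-replicate-suc-P′ : ∀ r q → q · (r ∷ replicate P′ r) ≡ q
  ·-replicate-suc-P′ r q = trans (cong (q ·_) (replicate-nQ! r)) (·-replicate-periodic r q)

  -- tᵣ has order dividing nQ !, so tᵣ⁻¹ acts as tᵣ^(nQ ! - 1).
  act-t⁻¹ : ∀ r q → act q (t r ⁻¹) ≡ q · replicate P′ r
  act-t⁻¹ r q = begin
    act q (t r ⁻¹)                               ≡⟨ ·-replicate-suc-P′ r _ ⟨
    act (act q (t r ⁻¹)) (t r) · replicate P′ r  ≡⟨ cong (_· replicate P′ r) (act⁻¹-act q (t r)) ⟩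
    q · replicate P′ r                           ∎
    where open ≡-Reasoning

  positiveWord : List (Fin 2 × Bool) → Word
  positiveWord []               = []
  positiveWord ((b , false) ∷ w) = b ∷ positiveWord w
  positiveWord ((b , true)  ∷ w) = replicate P′ b ++ positiveWord w

  act-evalGroupWord : ∀ q w → act q (evalGroupWord G t w) ≡ q · positiveWord w
  act-evalGroupWord q []               = act-ε q
  act-evalGroupWord q ((b , false) ∷ w) = trans (act-∙ q (t b) _) (act-evalGroupWord (act q (t b)) w)
  act-evalGroupWord q ((b , true)  ∷ w) = begin
    act q (t b ⁻¹ ∙ evalGroupWord G t w)            ≡⟨ act-∙ q (t b ⁻¹) _ ⟩
    act (act q (t b ⁻¹)) (evalGroupWord G t w)      ≡⟨ act-evalGroupWord (act q (t b ⁻¹)) w ⟩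
    act q (t b ⁻¹) · positiveWord w                 ≡⟨ cong (_· positiveWord w) (act-t⁻¹ b q) ⟩
    q · replicate P′ b · positiveWord w             ≡⟨ foldl-++ _ q (replicate P′ b) (positiveWord w) ⟨
    q · (replicate P′ b ++ positiveWord w)          ∎
    where open ≡-Reasoning

  positive : Carrier → Word
  positive g = positiveWord (proj₁ (generates g))

  act≡·positive : ∀ q g → act q g ≡ q · positive g
  act≡·positive q g = trans (act-cong q (≈-sym (proj₂ (generates g)))) (act-evalGroupWord q (proj₁ (generates g)))

  act≡·∷ʳ1 : ∀ g → ∃ λ v → ∀ q → act q g ≡ q · (v ∷ʳ 1F)
  act≡·∷ʳ1 g = positive g ++ replicate P′ 1F , λ q → begin
    act q g                                        ≡⟨ act≡·positive q g ⟩
    q · positive g                                 ≡⟨ ·-replicate-suc-P′ 1F _ ⟨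
    q · positive g · (1F ∷ replicate P′ 1F)        ≡⟨ cong (q · positive g ·_) (replicate-∷ʳ P′ 1F) ⟩
    q · positive g · (replicate P′ 1F ∷ʳ 1F)       ≡⟨ foldl-++ _ q (positive g) _ ⟨
    q · (positive g ++ replicate P′ 1F ∷ʳ 1F)      ≡⟨ cong (q ·_) (++-assoc (positive g) _ _) ⟨
    q · ((positive g ++ replicate P′ 1F) ∷ʳ 1F)    ∎
    where open ≡-Reasoning

  ⟦⟧≋⇔τ-act : ∀ {q q′} → ⟦ q ⟧ ≋ ⟦ q′ ⟧ ⇔ (∀ g → τ (act q g) ≡ τ (act q′ g))
  ⟦⟧≋⇔τ-act {q} {q′} = mk⇔
    (λ q≋q′ g → let (v , act≡) = act≡·∷ʳ1 g in
      trans (cong τ (act≡ q)) (trans (Equivalence.to ⟦⟧≋⇔τ-∷ʳ1 q≋q′ v) (cong τ (sym (act≡ q′)))))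
    (λ agree → Equivalence.from ⟦⟧≋⇔τ-∷ʳ1 λ v →
      trans (cong τ (sym (act-⟨⟩ q (v ∷ʳ 1F)))) (trans (agree ⟨ v ∷ʳ 1F ⟩) (cong τ (act-⟨⟩ q′ (v ∷ʳ 1F)))))

  ⟦⟧-Injective : Set
  ⟦⟧-Injective = ∀ q q′ → ⟦ q ⟧ ≋ ⟦ q′ ⟧ → q ≡ q′

  injective⇒dagger : ⟦⟧-Injective → Dagger
  injective⇒dagger injective h h-preserves-labels = injective _ _ (Equivalence.from ⟦⟧≋⇔τ-act λ g →
    trans (cong τ (sym (act-∙ q₀ h g))) (h-preserves-labels g))

  -- With q = q₀ᵍ and q′ = q₀ᵍ′, the element h = g′ g⁻¹ preserves labels, so (†) gives q′ᵍ⁻¹ = q₀.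
  dagger⇒injective : Dagger → ⟦⟧-Injective
  dagger⇒injective dagger q q′ q≋q′
    with g , q₀ᵍ≡q ← transitive q₀ q | g′ , q₀ᵍ′≡q′ ← transitive q₀ q′ = begin
    q                         ≡⟨ q₀ᵍ≡q ⟨
    act q₀ g                  ≡⟨ cong (λ x → act x g) q′ᵍ⁻¹≡q₀ ⟨
    act (act q′ (g ⁻¹)) g     ≡⟨ act⁻¹-act q′ g ⟩
    q′                        ∎
    where
    open ≡-Reasoning
    h = g′ ∙ g ⁻¹
    q₀ʰ≡q′ᵍ⁻¹ : act q₀ h ≡ act q′ (g ⁻¹)
    q₀ʰ≡q′ᵍ⁻¹ = trans (act-∙ q₀ g′ (g ⁻¹)) (cong (λ x → act x (g ⁻¹)) q₀ᵍ′≡q′)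
    qᵍ⁻¹≡q₀ : act q (g ⁻¹) ≡ q₀
    qᵍ⁻¹≡q₀ = trans (cong (λ x → act x (g ⁻¹)) (sym q₀ᵍ≡q)) (act-act⁻¹ q₀ g)
    h-preserves-labels : ∀ x → τ (act q₀ (h ∙ x)) ≡ τ (act q₀ x)
    h-preserves-labels x = begin
      τ (act q₀ (h ∙ x))          ≡⟨ cong τ (act-∙ q₀ h x) ⟩
      τ (act (act q₀ h) x)        ≡⟨ cong (λ y → τ (act y x)) q₀ʰ≡q′ᵍ⁻¹ ⟩
      τ (act (act q′ (g ⁻¹)) x)   ≡⟨ cong τ (act-∙ q′ (g ⁻¹) x) ⟨
      τ (act q′ (g ⁻¹ ∙ x))       ≡⟨ Equivalence.to ⟦⟧≋⇔τ-act q≋q′ (g ⁻¹ ∙ x) ⟨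
      τ (act q (g ⁻¹ ∙ x))        ≡⟨ cong τ (act-∙ q (g ⁻¹) x) ⟩
      τ (act (act q (g ⁻¹)) x)    ≡⟨ cong (λ y → τ (act y x)) qᵍ⁻¹≡q₀ ⟩
      τ (act q₀ x)                ∎
    q′ᵍ⁻¹≡q₀ : act q′ (g ⁻¹) ≡ q₀
    q′ᵍ⁻¹≡q₀ = trans (sym q₀ʰ≡q′ᵍ⁻¹) (dagger h h-preserves-labels)

  ⟦⟧∈N : ∀ q → InN 2 a ⟦ q ⟧
  ⟦⟧∈N q with g , q₀ᵍ≡q ← transitive q₀ q =
    InN-resp (≡⇒≋ (cong ⟦_⟧ (trans (sym (act≡·positive q₀ g)) q₀ᵍ≡q))) (reachable∈N (positive g))

  N-representative : ∀ {k} → HasCardN 2 a k → Fin k → Fin nQ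
  N-representative (u , u∈N , _) x = q₀ · proj₁ (InN⇒reachable (u x) (u∈N x))

  N-representative-injective : ∀ {k} (card : HasCardN 2 a k) → Injective _≡_ _≡_ (N-representative card)
  N-representative-injective card@(u , u∈N , u-injective , _) {x} {y} e = u-injective x y (≋⇒≈ˢ (begin
    u x                              ≈⟨ proj₂ (InN⇒reachable (u x) (u∈N x)) ⟩
    ⟦ N-representative card x ⟧      ≡⟨ cong ⟦_⟧ e ⟩
    ⟦ N-representative card y ⟧      ≈⟨ proj₂ (InN⇒reachable (u y) (u∈N y)) ⟨
    u y                              ∎))
    where open ≋-Reasoning

  card≤nQ : ∀ k → HasCardN 2 a k → k ≤ nQ
  card≤nQ k card = injective⇒≤ (N-representative-injective card)

  card≡nQ⇒injective : HasCardN 2 a nQ → ⟦⟧-Injective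
  card≡nQ⇒injective card@(u , u∈N , u-injective , _) q q′ q≋q′
    with x , ρx≡q ← injective⇒surjective _ (N-representative-injective card) q
       | y , ρy≡q′ ← injective⇒surjective _ (N-representative-injective card) q′ =
    trans (sym ρx≡q) (trans (cong ρ (u-injective x y (≋⇒≈ˢ ux≋uy))) ρy≡q′)
    where
    ρ = N-representative card
    ux≋uy : u x ≋ u y
    ux≋uy = begin
      u x       ≈⟨ proj₂ (InN⇒reachable (u x) (u∈N x)) ⟩
      ⟦ ρ x ⟧   ≡⟨ cong ⟦_⟧ ρx≡q ⟩
      ⟦ q ⟧     ≈⟨ q≋q′ ⟩
      ⟦ q′ ⟧    ≡⟨ cong ⟦_⟧ ρy≡q′ ⟨
      ⟦ ρ y ⟧   ≈⟨ proj₂ (InN⇒reachable (u y) (u∈N y)) ⟨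
      u y       ∎
      where open ≋-Reasoning

  ⟦⟧-surjective : ∀ u → InN 2 a u → ∃ λ q → ⟦ q ⟧ ≈ˢ u
  ⟦⟧-surjective u u∈N with w , u≋ ← InN⇒reachable u u∈N = q₀ · w , ≋⇒≈ˢ (≋-sym u≋)

  injective⇒card≡nQ : ⟦⟧-Injective → HasCardN 2 a nQ
  injective⇒card≡nQ injective =
    ⟦_⟧ , ⟦⟧∈N , (λ q q′ e → injective q q′ (mk≋ e)) ,
    λ v v∈N → let (q , ⟦q⟧≈v) = ⟦⟧-surjective v v∈N in q , ≋⇒≈ˢ (≋-sym (mk≋ {u = ⟦ q ⟧} {v} ⟦q⟧≈v))

  ∼-from-· : ∀ w w′ → (∀ q → q · w ≡ q · w′) → w ∼[ 2 , a ] w′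
  ∼-from-· w w′ same u u∈N with v , u≋ ← InN⇒reachable u u∈N = ≋⇒≈ˢ (begin
    tword 2 u w             ≈⟨ tword-cong w u≋ ⟩
    tword 2 ⟦ q₀ · v ⟧ w    ≈⟨ tword-⟦⟧ (q₀ · v) w ⟩
    ⟦ q₀ · v · w ⟧          ≡⟨ cong ⟦_⟧ (same (q₀ · v)) ⟩
    ⟦ q₀ · v · w′ ⟧         ≈⟨ tword-⟦⟧ (q₀ · v) w′ ⟨
    tword 2 ⟦ q₀ · v ⟧ w′   ≈⟨ tword-cong w′ u≋ ⟨
    tword 2 u w′            ∎)
    where open ≋-Reasoning

  injective⇒isoData : ⟦⟧-Injective → IsoData 2 a S
  injective⇒isoData injective =
    (positive , positive-cong , positive-∙ , positive-injective , positive-surjective , positive-t) ,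
    (⟦_⟧ , ⟦⟧∈N , (λ q q′ e → injective q q′ (mk≋ e)) , ⟦⟧-surjective , ≋⇒≈ˢ (≋-sym a≋⟦q₀⟧) ,
     λ q i → ≋⇒≈ˢ (≋-sym (tword-⟦⟧ q [ i ])))
    where
    positive-cong : ∀ g h → g ≈ h → positive g ∼[ 2 , a ] positive h
    positive-cong g h g≈h = ∼-from-· (positive g) (positive h) λ q →
      trans (sym (act≡·positive q g)) (trans (act-cong q g≈h) (act≡·positive q h))
    positive-∙ : ∀ g h → positive (g ∙ h) ∼[ 2 , a ] (positive g ++ positive h)
    positive-∙ g h = ∼-from-· (positive (g ∙ h)) (positive g ++ positive h) λ q → begin
      q · positive (g ∙ h)              ≡⟨ act≡·positive q (g ∙ h) ⟨
      act q (g ∙ h)                     ≡⟨ act-∙ q g h ⟩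
      act (act q g) h                   ≡⟨ cong (λ x → act x h) (act≡·positive q g) ⟩
      act (q · positive g) h            ≡⟨ act≡·positive _ h ⟩
      q · positive g · positive h       ≡⟨ foldl-++ _ q (positive g) (positive h) ⟨
      q · (positive g ++ positive h)    ∎
      where open ≡-Reasoning
    positive-injective : ∀ g h → positive g ∼[ 2 , a ] positive h → g ≈ h
    positive-injective g h g∼h = faithful g h λ q → injective _ _ (begin
      ⟦ act q g ⟧                 ≡⟨ cong ⟦_⟧ (act≡·positive q g) ⟩
      ⟦ q · positive g ⟧          ≈⟨ tword-⟦⟧ q (positive g) ⟨
      tword 2 ⟦ q ⟧ (positive g)  ≈⟨ mk≋ (g∼h ⟦ q ⟧ (⟦⟧∈N q)) ⟩
      tword 2 ⟦ q ⟧ (positive h)  ≈⟨ tword-⟦⟧ q (positive h) ⟩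
      ⟦ q · positive h ⟧          ≡⟨ cong ⟦_⟧ (act≡·positive q h) ⟨
      ⟦ act q h ⟧                 ∎)
      where open ≋-Reasoning
    positive-surjective : ∀ w → Σ Carrier λ g → positive g ∼[ 2 , a ] w
    positive-surjective w = ⟨ w ⟩ , ∼-from-· (positive ⟨ w ⟩) w λ q → trans (sym (act≡·positive q ⟨ w ⟩)) (act-⟨⟩ q w)
    positive-t : ∀ i → positive (t i) ∼[ 2 , a ] [ i ]
    positive-t i = ∼-from-· (positive (t i)) [ i ] λ q → sym (act≡·positive q (t i))

  schreier⇒globalRelations : GlobalRelationsOfAllTypes 2 a
  schreier⇒globalRelations r r<2 =
    let (global , type) = periodic⇒globalRelation a r′ (1≤n! nQ) periodic
    in nQ ! , num (replicate (nQ !) r′) , global , trans type (toℕ-fromℕ< r<2)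
    where
    r′ = fromℕ< r<2
    periodic : Periodic a r′ (nQ !)
    periodic u u∈N with v , u≋ ← InN⇒reachable u u∈N = begin
      tword 2 u period             ≈⟨ tword-cong period u≋ ⟩
      tword 2 ⟦ q₀ · v ⟧ period    ≈⟨ tword-⟦⟧ (q₀ · v) period ⟩
      ⟦ q₀ · v · period ⟧          ≡⟨ cong ⟦_⟧ (·-replicate-periodic r′ (q₀ · v)) ⟩
      ⟦ q₀ · v ⟧                   ≈⟨ u≋ ⟨
      u                            ∎
      where
      open ≋-Reasoning
      period = replicate (nQ !) r′

module Enumeration {Δ : Set} (_≟_ : DecidableEquality Δ) (A : Automaton 2 Δ) (a : Seq Δ) (produces : Produces A a) where
  open Automaton A
  open Kernel A a produces

  pair-step : Fin nQ × Fin nQ → Fin 2 → Fin nQ × Fin nQ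
  pair-step (q , q′) b = δ q b , δ q′ b

  foldl-pair-step : ∀ q q′ v → foldl pair-step (q , q′) v ≡ (q · v , q′ · v)
  foldl-pair-step q q′ []      = refl
  foldl-pair-step q q′ (b ∷ v) = foldl-pair-step (δ q b) (δ q′ b) v

  encode-pair : Fin nQ × Fin nQ → Fin (nQ * nQ)
  encode-pair (q , q′) = combine q q′

  encode-pair-injective : Injective _≡_ _≡_ encode-pair
  encode-pair-injective {q , q′} {p , p′} e = let (q≡p , q′≡p′) = combine-injective q q′ p p′ e in cong₂ _,_ q≡p q′≡p′

  ·-∷ʳ-cong : ∀ {q} v v′ b → q · v ≡ q · v′ → q · (v ∷ʳ b) ≡ q · (v′ ∷ʳ b)
  ·-∷ʳ-cong {q} v v′ b e = trans (foldl-∷ʳ δ q b v) (trans (cong (λ x → δ x b) e) (sym (foldl-∷ʳ δ q b v′)))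

  -- Two states are distinguished, if at all, by a word shorter than the number of pairs of states.
  ⟦⟧≋? : ∀ q q′ → Dec (⟦ q ⟧ ≋ ⟦ q′ ⟧)
  ⟦⟧≋? q q′ = map′ agree⇒≋ ≋⇒agree (All.all? (λ v → τ (q · (v ∷ʳ 1F)) ≟ τ (q′ · (v ∷ʳ 1F))) (words< (nQ * nQ)))
    where
    open Pumping encode-pair encode-pair-injective pair-step using (shorten)
    AgreeOn : Word → Set
    AgreeOn v = τ (q · (v ∷ʳ 1F)) ≡ τ (q′ · (v ∷ʳ 1F))
    ≋⇒agree : ⟦ q ⟧ ≋ ⟦ q′ ⟧ → All.All AgreeOn (words< (nQ * nQ))
    ≋⇒agree q≋q′ = All.tabulate λ {v} _ → Equivalence.to ⟦⟧≋⇔τ-∷ʳ1 q≋q′ v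
    agree⇒≋ : All.All AgreeOn (words< (nQ * nQ)) → ⟦ q ⟧ ≋ ⟦ q′ ⟧
    agree⇒≋ agree = Equivalence.from ⟦⟧≋⇔τ-∷ʳ1 λ v →
      let (v′ , short , same) = shorten (q , q′) v
          same-pair = trans (sym (foldl-pair-step q q′ v′)) (trans same (foldl-pair-step q q′ v))
      in begin
      τ (q · (v ∷ʳ 1F))    ≡⟨ cong τ (·-∷ʳ-cong v′ v 1F (cong proj₁ same-pair)) ⟨
      τ (q · (v′ ∷ʳ 1F))   ≡⟨ All.lookup agree (∈-words< v′ short) ⟩
      τ (q′ · (v′ ∷ʳ 1F))  ≡⟨ cong τ (·-∷ʳ-cong v′ v 1F (cong proj₂ same-pair)) ⟩
      τ (q′ · (v ∷ʳ 1F))   ∎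
      where open ≡-Reasoning

  _~_ : Word → Word → Set
  w ~ w′ = ⟦ q₀ · w ⟧ ≋ ⟦ q₀ · w′ ⟧

  open Deduplication _~_ ≋-refl ≋-sym (λ w w′ → ⟦⟧≋? (q₀ · w) (q₀ · w′))
  open Representatives (representatives (words< nQ))

  k : ℕ
  k = length reps

  rep : Fin k → Word
  rep = lookup reps

  class-of : ∀ w → ∃ λ i → w ~ rep i
  class-of w =
    let (w′ , short , same) = Pumping.shorten (λ q → q) (λ e → e) δ q₀ w
        (i , w′~rᵢ) = cover (∈-words< w′ short)
    in i , ≋-trans (≡⇒≋ (cong ⟦_⟧ (sym same))) w′~rᵢ

  class : Word → Fin k
  class w = proj₁ (class-of w)

  class-correct : ∀ w → w ~ rep (class w)
  class-correct w = proj₂ (class-of w)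

  class-cong : ∀ w w′ → w ~ w′ → class w ≡ class w′
  class-cong w w′ w~w′ = distinct _ _ (≋-trans (≋-sym (class-correct w)) (≋-trans w~w′ (class-correct w′)))

  class-rep : ∀ i → class (rep i) ≡ i
  class-rep i = distinct _ _ (≋-sym (class-correct (rep i)))

  ~-∷ʳ : ∀ w w′ b → w ~ w′ → (w ∷ʳ b) ~ (w′ ∷ʳ b)
  ~-∷ʳ w w′ b w~w′ = begin
    ⟦ q₀ · (w ∷ʳ b) ⟧          ≈⟨ ⟦⟧-∷ʳ q₀ w b ⟩
    tmap 2 ⟦ q₀ · w ⟧ (toℕ b)   ≈⟨ tword-cong [ b ] w~w′ ⟩
    tmap 2 ⟦ q₀ · w′ ⟧ (toℕ b)  ≈⟨ ⟦⟧-∷ʳ q₀ w′ b ⟨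
    ⟦ q₀ · (w′ ∷ʳ b) ⟧         ∎
    where open ≋-Reasoning

  σ : Fin 2 → Fin k → Fin k
  σ b i = class (rep i ∷ʳ b)

  class-∷ʳ : ∀ w b → class (w ∷ʳ b) ≡ σ b (class w)
  class-∷ʳ w b = class-cong (w ∷ʳ b) (rep (class w) ∷ʳ b) (~-∷ʳ w (rep (class w)) b (class-correct w))

  class-++ : ∀ w v → foldl (λ i b → σ b i) (class w) v ≡ class (w ++ v)
  class-++ w []      = cong class (sym (++-identityʳ w))
  class-++ w (b ∷ v) = begin
    foldl (λ i b → σ b i) (σ b (class w)) v     ≡⟨ cong (λ i → foldl (λ i b → σ b i) i v) (class-∷ʳ w b) ⟨
    foldl (λ i b → σ b i) (class (w ∷ʳ b)) v    ≡⟨ class-++ (w ∷ʳ b) v ⟩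
    class ((w ∷ʳ b) ++ v)                       ≡⟨ cong class (++-assoc w [ b ] v) ⟩
    class (w ++ b ∷ v)                          ∎
    where open ≡-Reasoning

  module _ (isGroup : GIsGroup 2 a) where

    σ-injective : ∀ b {i j} → σ b i ≡ σ b j → i ≡ j
    σ-injective b {i} {j} σᵢ≡σⱼ = distinct i j (mk≋ (proj₁ (isGroup b) rᵢ rⱼ (reachable∈N (rep i)) (reachable∈N (rep j))
      (≋⇒≈ˢ (begin
      tmap 2 rᵢ (toℕ b)          ≈⟨ ⟦⟧-∷ʳ q₀ (rep i) b ⟨
      ⟦ q₀ · (rep i ∷ʳ b) ⟧     ≈⟨ class-correct (rep i ∷ʳ b) ⟩
      ⟦ q₀ · rep (σ b i) ⟧      ≡⟨ cong (λ l → ⟦ q₀ · rep l ⟧) σᵢ≡σⱼ ⟩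
      ⟦ q₀ · rep (σ b j) ⟧      ≈⟨ class-correct (rep j ∷ʳ b) ⟨
      ⟦ q₀ · (rep j ∷ʳ b) ⟧     ≈⟨ ⟦⟧-∷ʳ q₀ (rep j) b ⟩
      tmap 2 rⱼ (toℕ b)          ∎))))
      where
      open ≋-Reasoning
      rᵢ = ⟦ q₀ · rep i ⟧
      rⱼ = ⟦ q₀ · rep j ⟧

    σ-surjective : ∀ b i → ∃ λ j → σ b j ≡ i
    σ-surjective b i =
      let (u , u∈N , tᵦu≈rᵢ) = proj₂ (isGroup b) ⟦ q₀ · rep i ⟧ (reachable∈N (rep i))
          (w , u≋) = InN⇒reachable u u∈N
          wb~rᵢ = ≋-trans (⟦⟧-∷ʳ q₀ w b) (≋-trans (tword-cong [ b ] (≋-sym u≋)) (mk≋ {u = tmap 2 u (toℕ b)} tᵦu≈rᵢ))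
      in class w , trans (sym (class-∷ʳ w b)) (trans (class-cong (w ∷ʳ b) (rep i) wb~rᵢ) (class-rep i))

    σ⁻¹ : Fin 2 → Fin k → Fin k
    σ⁻¹ b i = proj₁ (σ-surjective b i)

    σ-σ⁻¹ : ∀ b i → σ b (σ⁻¹ b i) ≡ i
    σ-σ⁻¹ b i = proj₂ (σ-surjective b i)

    σ⁻¹-σ : ∀ b i → σ⁻¹ b (σ b i) ≡ i
    σ⁻¹-σ b i = σ-injective b (σ-σ⁻¹ b (σ b i))

    open PermutationSchreier σ σ⁻¹ σ⁻¹-σ σ-σ⁻¹

    reach : ∀ i → ∃ λ g → class [] ⊙ g ≡ i
    reach i = map (_, false) (rep i) , trans (⊙-positive (class []) (rep i)) (trans (class-++ [] (rep i)) (class-rep i))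

    -- The label of u ∈ N(a) is the first term of u^{t₁⁻¹}; for u = a^{t_v t₁} it is a_{num (v ∷ʳ 1)}.
    label : Fin k → Δ
    label i = ⟦ q₀ · rep i · replicate P′ 1F ⟧ 1

    label-class : ∀ v → label (class (v ∷ʳ 1F)) ≡ τ (q₀ · (v ∷ʳ 1F))
    label-class v = trans (≋⇒≈ˢ chain 0) (cong τ (sym (foldl-∷ʳ δ q₀ 1F v)))
      where
      open ≋-Reasoning
      i = class (v ∷ʳ 1F)
      chain : ⟦ q₀ · rep i · replicate P′ 1F ⟧ ≋ ⟦ q₀ · v ⟧
      chain = begin
        ⟦ q₀ · rep i · replicate P′ 1F ⟧              ≈⟨ tword-⟦⟧ (q₀ · rep i) (replicate P′ 1F) ⟨
        tword 2 ⟦ q₀ · rep i ⟧ (replicate P′ 1F)      ≈⟨ tword-cong (replicate P′ 1F) (class-correct (v ∷ʳ 1F)) ⟨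
        tword 2 ⟦ q₀ · (v ∷ʳ 1F) ⟧ (replicate P′ 1F)  ≈⟨ tword-cong (replicate P′ 1F) (⟦⟧-∷ʳ q₀ v 1F) ⟩
        tword 2 ⟦ q₀ · v ⟧ (1F ∷ replicate P′ 1F)     ≡⟨ cong (tword 2 ⟦ q₀ · v ⟧) (replicate-nQ! 1F) ⟩
        tword 2 ⟦ q₀ · v ⟧ (replicate (nQ !) 1F)      ≈⟨ injective⇒periodic 1F (proj₁ (isGroup 1F)) _ (reachable∈N v) ⟩
        ⟦ q₀ · v ⟧                                    ∎

    schreier : SchreierAutomaton 2 Δ
    schreier = schreierAutomaton (class []) reach label

    schreier-produces : Produces (SchreierAutomaton.automaton schreier) a
    schreier-produces m = let (v , bits≡ , _) = bits-suc m in begin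
      a (suc m)                                       ≡⟨ ≋⇒≈ˢ a≋⟦q₀⟧ m ⟩
      τ (q₀ · bits (suc m))                           ≡⟨ cong (λ w → τ (q₀ · w)) bits≡ ⟩
      τ (q₀ · (v ∷ʳ 1F))                              ≡⟨ label-class v ⟨
      label (class (v ∷ʳ 1F))                         ≡⟨ cong (λ w → label (class w)) bits≡ ⟨
      label (class (bits (suc m)))                    ≡⟨ cong label (class-++ [] (bits (suc m))) ⟨
      label (foldl (λ i b → σ b i) (class []) (bits (suc m)))  ≡⟨ cong label (runF≡foldl-binary (λ i b → σ b i) (suc m) (class []) (suc m)) ⟨
      output (SchreierAutomaton.automaton schreier) (suc m)   ∎
      where open ≡-Reasoning

    group⇒schreier : ProducedBySchreier 2 a
    group⇒schreier = schreier , schreier-produces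

mainTheorem3 : ∀ {d : ℕ} (a : Seq (Fin d)) → IsAutomatic 2 a →
    ((GlobalRelationsOfAllTypes 2 a → GIsGroup 2 a)
     × (GIsGroup 2 a → ProducedBySchreier 2 a)
     × (ProducedBySchreier 2 a → GlobalRelationsOfAllTypes 2 a))
    × (∀ (S : SchreierAutomaton 2 (Fin d)) →
         Produces (SchreierAutomaton.automaton S) a →
         (∀ k → HasCardN 2 a k → k ≤ SchreierAutomaton.nQ S)
         × (HasCardN 2 a (SchreierAutomaton.nQ S) ⇔ SchreierAutomaton.Dagger S)
         × (HasCardN 2 a (SchreierAutomaton.nQ S) → IsoData 2 a S))
mainTheorem3 a (A , produces) =
  ( Kernel.globalRelations⇒group A a produces
  , Enumeration.group⇒schreier _≟ᶠ_ A a produces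
  , λ (S , S-produces) → Schreier.schreier⇒globalRelations S a S-produces )
  , λ S S-produces → let open Schreier S a S-produces in
      card≤nQ
    , mk⇔ (injective⇒dagger ∘ card≡nQ⇒injective) (injective⇒card≡nQ ∘ dagger⇒injective)
    , injective⇒isoData ∘ card≡nQ⇒injective
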